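{- Let $G$ be a connected graph of order at least three. Then $\gamma_{cI}(G)=2\beta(G)$ if and only if $G\in\mathcal{G}$.
   Context: All graphs are finite and simple. $\beta(G)$ is the vertex cover number of $G$. A function $f:V(G)\to\{0,1,2\}$ is a covering Italian dominating function (CID function) of $G$ if (i) for every vertex $v$ with $f(v)=0$ we have $\sum_{u\in N(v)} f(u)\geq 2$, where $N(v)$ is the open neighborhood of $v$, and (ii) the set $\{v: f(v)=0\}$ is independent. $\gamma_{cI}(G)$ is the minimum of $\sum_v f(v)$ over all CID functions $f$ of $G$. A leaf is a vertex of degree one. The family $\mathcal{G}$ consists of the graphs $G$ constructed from a graph $H$ (an induced subgraph of $G$) such that $S=V(G)\setminus V(H)$ is an independent set, every vertex of $H$ is adjacent to at least two vertices of $S$, at least one of which is a leaf of $G$, and moreover, for every $k$ and every set of $k$ independent vertices of $H$ chosen among those vertices of $H$ adjacent to exactly one leaf in $S$, these $k$ vertices have together at least $k$ (pairwise independent) non-leaf neighbors in $S$. -}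

module Defs where

open import Data.Nat using (ℕ; zero; suc; _+_; _*_; _≤_; _≡ᵇ_)
open import Data.Bool using (Bool; true; false; if_then_else_; _∧_; not)
open import Data.Fin using (Fin)
open import Data.List using (List; map; allFin)
open import Data.Nat.ListAction using (sum)
open import Data.Bool.ListAction using (any)
open import Data.Product using (Σ; _×_; ∃)
open import Data.Sum using (_⊎_)
open import Relation.Nullary using (¬_)
open import Relation.Binary.PropositionalEquality using (_≡_)

record Graph : Set where
  field
    n      : ℕ
    adj    : Fin n → Fin n → Bool
    sym    : ∀ u v → adj u v ≡ adj v u
    irrefl : ∀ v → adj v v ≡ false
open Graph public

Σv : ∀ {n} → (Fin n → ℕ) → ℕ
Σv {n} f = sum (map f (allFin n))

count : ∀ {n} → (Fin n → Bool) → ℕ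
count P = Σv (λ v → if P v then 1 else 0)

nbrSum : (G : Graph) → (Fin (n G) → ℕ) → Fin (n G) → ℕ
nbrSum G f v = Σv (λ u → if adj G v u then f u else 0)

degree : (G : Graph) → Fin (n G) → ℕ
degree G v = count (adj G v)

isLeaf : (G : Graph) → Fin (n G) → Bool
isLeaf G v = degree G v ≡ᵇ 1

data Reach (G : Graph) : Fin (n G) → Fin (n G) → Set where
  here : ∀ {v} → Reach G v v
  step : ∀ {u w v} → adj G u w ≡ true → Reach G w v → Reach G u v

Connected : Graph → Set
Connected G = ∀ u v → Reach G u v

Independent : (G : Graph) → (Fin (n G) → Bool) → Set
Independent G S = ∀ u v → S u ≡ true → S v ≡ true → adj G u v ≡ false

IsVertexCover : (G : Graph) → (Fin (n G) → Bool) → Set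
IsVertexCover G C = ∀ u v → adj G u v ≡ true → C u ≡ true ⊎ C v ≡ true

IsVertexCoverNumber : Graph → ℕ → Set
IsVertexCoverNumber G b =
  (Σ (Fin (n G) → Bool) λ C → IsVertexCover G C × count C ≡ b)
  × (∀ C → IsVertexCover G C → b ≤ count C)

weight : ∀ {n} → (Fin n → ℕ) → ℕ
weight f = Σv f

record IsCID (G : Graph) (f : Fin (n G) → ℕ) : Set where
  field
    range      : ∀ v → f v ≤ 2
    italian    : ∀ v → f v ≡ 0 → 2 ≤ nbrSum G f v
    zeroIndep  : ∀ u v → f u ≡ 0 → f v ≡ 0 → adj G u v ≡ false

IsCIDNumber : Graph → ℕ → Set
IsCIDNumber G c =
  (Σ (Fin (n G) → ℕ) λ f → IsCID G f × weight f ≡ c)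
  × (∀ f → IsCID G f → c ≤ weight f)

leafNbrsIn : (G : Graph) → (Fin (n G) → Bool) → Fin (n G) → ℕ
leafNbrsIn G S v = count (λ s → S s ∧ adj G v s ∧ isLeaf G s)

nonLeafNbrsOfSetIn : (G : Graph) → (Fin (n G) → Bool) → (Fin (n G) → Bool) → ℕ
nonLeafNbrsOfSetIn G S I =
  count (λ s → S s ∧ not (isLeaf G s) ∧ any (λ v → I v ∧ adj G v s) (allFin (n G)))

-- The family 𝒢, witnessed by S = V(G) \ V(H) (H = G - S is induced).
record InFamilyWith (G : Graph) (S : Fin (n G) → Bool) : Set where
  field
    S-indep   : Independent G S
    twoNbrs   : ∀ v → S v ≡ false →
                Σ (Fin (n G)) λ s₁ → Σ (Fin (n G)) λ s₂ →
                  ¬ (s₁ ≡ s₂) × S s₁ ≡ true × S s₂ ≡ true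
                  × adj G v s₁ ≡ true × adj G v s₂ ≡ true
                  × isLeaf G s₁ ≡ true
    hall      : ∀ (I : Fin (n G) → Bool) → Independent G I →
                (∀ v → I v ≡ true → S v ≡ false × leafNbrsIn G S v ≡ 1) →
                count I ≤ nonLeafNbrsOfSetIn G S I

InFamily : Graph → Set
InFamily G = Σ (Fin (n G) → Bool) λ S → InFamilyWith G S

module Submission where

-- Doubling the indicator of a vertex cover C gives a CID function of weight 2|C|, so
-- γ_cI ≤ 2β.  If G ∈ 𝒢 via S, then V ∖ S is a vertex cover, and every CID function f
-- pays at least 2 for each v ∉ S out of f(v), the weight of f on the leaves of S at v
-- (a leaf is charged to one v only) and, when f(v) = 0 and v has a single such leaf,
-- one unit lent by a non-leaf neighbour of v in S, which has positive weight; the Hall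
-- condition supplies enough lenders, so weight f ≥ 2|V ∖ S| ≥ 2β.  Conversely, let
-- γ_cI = 2β, C a minimum vertex cover and S = V ∖ C.  If some v ∈ C had no leaf
-- neighbour in S, lowering v to 1; if it had a leaf s as its only S-neighbour, moving
-- v to 0 and s to 1; and if an independent set I of vertices with one leaf each
-- violated the Hall condition, moving I to 0 and the S-neighbours of I to 1 would each
-- turn 2·𝟙_C into a lighter CID function.

open import Data.Nat.Properties hiding (_≟_)
open import Algebra.Properties.CommutativeSemigroup +-commutativeSemigroup using (x∙yz≈y∙xz)
open import Algebra.Properties.Semiring.Sum +-*-semiring
  using (sum; sum-remove; sum-cong-≗; sum-replicate-zero; ∑-distrib-+; ∑-comm; *-distribʳ-sum)
open import Data.Bool using (Bool; true; false; if_then_else_; _∧_; not)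
import Data.Bool.Properties as Bool
open import Data.Bool.ListAction using (any)
open import Data.Empty using (⊥; ⊥-elim)
open import Data.Fin using (Fin; zero; suc; punchOut)
open import Data.Fin.Properties using (_≟_; any?; punchInᵢ≢i; punchIn-punchOut)
open import Data.List using (allFin; tabulate)
open import Data.List.Membership.Propositional using (lose)
open import Data.List.Membership.Propositional.Properties using (∈-allFin)
open import Data.List.Properties using (map-tabulate)
open import Data.List.Relation.Unary.Any using (satisfied)
open import Data.List.Relation.Unary.Any.Properties using (any⁺; any⁻)
open import Data.Nat using (ℕ; zero; suc; _+_; _*_; _≤_; _<_; z≤n; s≤s; _≡ᵇ_; _≤?_)
import Data.Nat.ListAction as List
open import Data.Product using (Σ; _×_; _,_; ∃; proj₁; proj₂)
open import Data.Sum using (_⊎_; inj₁; inj₂)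
open import Data.Vec.Functional using (removeAt; updateAt)
open import Data.Vec.Functional.Properties using (updateAt-updates; updateAt-minimal)
open import Function using (_∘_; id; const)
open import Function.Bundles using (Equivalence)
open import Relation.Nullary using (¬_; yes; no; contradiction)
open import Relation.Nullary.Decidable using (_×-dec_; ¬?)
open import Relation.Binary.PropositionalEquality
  using (_≡_; _≢_; refl; sym; trans; cong; cong₂; subst; subst₂; module ≡-Reasoning)

open import Defs renaming (sym to adj-sym)

private variable
  m : ℕ
  f g : Fin m → ℕ

[_] : Bool → ℕ
[ b ] = if b then 1 else 0

Σv-sum : (f : Fin m → ℕ) → Σv f ≡ sum f
Σv-sum f = trans (cong List.sum (map-tabulate id f)) (sum-tabulate f)
  where
  sum-tabulate : ∀ {m} (f : Fin m → ℕ) → List.sum (tabulate f) ≡ sum f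
  sum-tabulate {zero}  f = refl
  sum-tabulate {suc m} f = cong (f zero +_) (sum-tabulate (f ∘ suc))

Σv-cong : (∀ x → f x ≡ g x) → Σv f ≡ Σv g
Σv-cong {f = f} {g} f≗g = trans (Σv-sum f) (trans (sum-cong-≗ f≗g) (sym (Σv-sum g)))

Σv-distrib-+ : (f g : Fin m → ℕ) → Σv (λ x → f x + g x) ≡ Σv f + Σv g
Σv-distrib-+ f g = begin
  Σv (λ x → f x + g x)   ≡⟨ Σv-sum (λ x → f x + g x) ⟩
  sum (λ x → f x + g x)  ≡⟨ ∑-distrib-+ f g ⟩
  sum f + sum g          ≡⟨ sym (cong₂ _+_ (Σv-sum f) (Σv-sum g)) ⟩
  Σv f + Σv g            ∎
  where open ≡-Reasoning

Σv-comm : (h : Fin m → Fin m → ℕ) → Σv (λ x → Σv (h x)) ≡ Σv (λ y → Σv (λ x → h x y))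
Σv-comm h = begin
  Σv (λ x → Σv (h x))            ≡⟨ Σv-sum² h ⟩
  sum (λ x → sum (h x))          ≡⟨ ∑-comm h ⟩
  sum (λ y → sum (λ x → h x y))  ≡⟨ sym (Σv-sum² (λ y x → h x y)) ⟩
  Σv (λ y → Σv (λ x → h x y))    ∎
  where
  open ≡-Reasoning
  Σv-sum² : (k : Fin m → Fin m → ℕ) → Σv (λ x → Σv (k x)) ≡ sum (λ x → sum (k x))
  Σv-sum² k = trans (Σv-cong (λ x → Σv-sum (k x))) (Σv-sum (λ x → sum (k x)))

Σv-mono-≤ : (∀ x → f x ≤ g x) → Σv f ≤ Σv g
Σv-mono-≤ {f = f} {g} f≤g = subst₂ _≤_ (sym (Σv-sum f)) (sym (Σv-sum g)) (sum-mono f≤g)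
  where
  sum-mono : ∀ {m} {f g : Fin m → ℕ} → (∀ x → f x ≤ g x) → sum f ≤ sum g
  sum-mono {zero}  _   = z≤n
  sum-mono {suc m} f≤g = +-mono-≤ (f≤g zero) (sum-mono (f≤g ∘ suc))

Σv-zero : (f : Fin m → ℕ) → (∀ x → f x ≡ 0) → Σv f ≡ 0
Σv-zero {m} f f≗0 = trans (Σv-cong f≗0) (trans (Σv-sum {m} (λ _ → 0)) (sum-replicate-zero m))

Σv-remove : (f : Fin (suc m) → ℕ) (a : Fin (suc m)) → Σv f ≡ f a + sum (removeAt f a)
Σv-remove f a = trans (Σv-sum f) (sum-remove f)

Σv-≥-term : (f : Fin m → ℕ) (a : Fin m) → f a ≤ Σv f
Σv-≥-term {suc m} f a = subst (f a ≤_) (sym (Σv-remove f a)) (m≤m+n (f a) _)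

Σv-≥-pair : (f : Fin m → ℕ) {a b : Fin m} → a ≢ b → f a + f b ≤ Σv f
Σv-≥-pair {suc m} f {a} {b} a≢b = begin
  f a + f b                    ≡⟨ cong (λ x → f a + f x) (sym (punchIn-punchOut a≢b)) ⟩
  f a + f′ (punchOut a≢b)      ≤⟨ +-monoʳ-≤ (f a) (subst (f′ (punchOut a≢b) ≤_) (Σv-sum f′)
                                                  (Σv-≥-term f′ _)) ⟩
  f a + sum f′                 ≡⟨ sym (Σv-remove f a) ⟩
  Σv f                         ∎
  where
  open ≤-Reasoning
  f′ : Fin m → ℕ
  f′ = removeAt f a

Σv-if-≥-term : (P : Fin m → Bool) (f : Fin m → ℕ) {a : Fin m} → P a ≡ true →
               f a ≤ Σv (λ x → if P x then f x else 0)
Σv-if-≥-term P f {a} Pa =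
  subst (_≤ Σv (λ x → if P x then f x else 0)) (cong (λ b → if b then f a else 0) Pa)
    (Σv-≥-term (λ x → if P x then f x else 0) a)

Σv-agree-off : (a : Fin m) → (∀ x → x ≢ a → f x ≡ g x) → f a + Σv g ≡ g a + Σv f
Σv-agree-off {suc m} {f} {g} a f≗g = begin
  f a + Σv g                          ≡⟨ cong (f a +_) (Σv-remove g a) ⟩
  f a + (g a + sum (removeAt g a))    ≡⟨ x∙yz≈y∙xz (f a) (g a) _ ⟩
  g a + (f a + sum (removeAt g a))    ≡⟨ cong (λ s → g a + (f a + s)) (sum-cong-≗ agree) ⟩
  g a + (f a + sum (removeAt f a))    ≡⟨ cong (g a +_) (sym (Σv-remove f a)) ⟩
  g a + Σv f                          ∎
  where
  open ≡-Reasoning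
  agree : ∀ k → removeAt g a k ≡ removeAt f a k
  agree k = sym (f≗g _ (punchInᵢ≢i a k))

Σv-supported-at : (a : Fin m) → (∀ x → x ≢ a → f x ≡ 0) → Σv f ≡ f a
Σv-supported-at {m} {f} a f≗0 = begin
  Σv f                    ≡⟨ sym (Σv-agree-off a f≗0) ⟩
  f a + Σv {m} (λ _ → 0)  ≡⟨ cong (f a +_) (Σv-zero {m} (λ _ → 0) (λ _ → refl)) ⟩
  f a + 0                 ≡⟨ +-identityʳ (f a) ⟩
  f a                     ∎
  where open ≡-Reasoning

Σv-if-const : (P : Fin m → Bool) (x : ℕ) → Σv (λ v → if P v then x else 0) ≡ count P * x
Σv-if-const P x = begin
  Σv (λ v → if P v then x else 0)  ≡⟨ Σv-cong (λ v → if-times (P v)) ⟩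
  Σv (λ v → [ P v ] * x)           ≡⟨ Σv-sum (λ v → [ P v ] * x) ⟩
  sum (λ v → [ P v ] * x)          ≡⟨ sym (*-distribʳ-sum x (λ v → [ P v ])) ⟩
  sum (λ v → [ P v ]) * x          ≡⟨ cong (_* x) (sym (Σv-sum (λ v → [ P v ]))) ⟩
  count P * x                      ∎
  where
  open ≡-Reasoning
  if-times : ∀ b → (if b then x else 0) ≡ [ b ] * x
  if-times true  = sym (*-identityˡ x)
  if-times false = refl

weight-partition : (P Q : Fin m → Bool) (f : Fin m → ℕ) →
                   Σv (λ v → if not (P v) then f v else 0) + Σv (λ v → if P v ∧ Q v then f v else 0)
                     + Σv (λ v → if P v ∧ not (Q v) then f v else 0) ≡ weight f
weight-partition {m} P Q f = begin
  Σv out + Σv inQ + Σv in¬Q             ≡⟨ cong (_+ Σv in¬Q) (sym (Σv-distrib-+ out inQ)) ⟩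
  Σv (λ v → out v + inQ v) + Σv in¬Q    ≡⟨ sym (Σv-distrib-+ (λ v → out v + inQ v) in¬Q) ⟩
  Σv (λ v → out v + inQ v + in¬Q v)     ≡⟨ Σv-cong (λ v → pieces (P v) (Q v) (f v)) ⟩
  Σv f                                  ∎
  where
  open ≡-Reasoning
  out inQ in¬Q : Fin m → ℕ
  out  v = if not (P v) then f v else 0
  inQ  v = if P v ∧ Q v then f v else 0
  in¬Q v = if P v ∧ not (Q v) then f v else 0
  pieces : ∀ p q x →
           (if not p then x else 0) + (if p ∧ q then x else 0) + (if p ∧ not q then x else 0) ≡ x
  pieces false _     x = trans (+-identityʳ (x + 0)) (+-identityʳ x)
  pieces true  true  x = +-identityʳ x
  pieces true  false x = refl

updateAt-cases : (f : Fin m → ℕ) (a : Fin m) (k : ℕ) (u : Fin m) →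
                 (u ≡ a × updateAt f a (const k) u ≡ k) ⊎ (u ≢ a × updateAt f a (const k) u ≡ f u)
updateAt-cases f a k u with u ≟ a
... | yes refl = inj₁ (refl , updateAt-updates u f)
... | no u≢a   = inj₂ (u≢a , updateAt-minimal u a f u≢a)

updateAt-≤ : ∀ {b k} → (∀ u → f u ≤ b) → k ≤ b → ∀ a u → updateAt f a (const k) u ≤ b
updateAt-≤ {f = f} {k = k} f≤b k≤b a u with updateAt-cases f a k u
... | inj₁ (_ , eq) = subst (_≤ _) (sym eq) k≤b
... | inj₂ (_ , eq) = subst (_≤ _) (sym eq) (f≤b u)

Σv-updateAt : (f : Fin m → ℕ) (a : Fin m) (k : ℕ) → f a + Σv (updateAt f a (const k)) ≡ k + Σv f
Σv-updateAt f a k =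
  trans (Σv-agree-off a (λ x x≢a → sym (updateAt-minimal x a f x≢a))) (cong (_+ Σv f) (updateAt-updates a f))

any-allFin⁺ : (p : Fin m → Bool) (a : Fin m) → p a ≡ true → any p (allFin m) ≡ true
any-allFin⁺ p a pa = Equivalence.to Bool.T-≡ (any⁺ p (lose (∈-allFin a) (Equivalence.from Bool.T-≡ pa)))

any-allFin⁻ : (p : Fin m → Bool) → any p (allFin m) ≡ true → ∃ λ a → p a ≡ true
any-allFin⁻ {m} p any≡true with satisfied (any⁻ p (allFin m) (Equivalence.from Bool.T-≡ any≡true))
... | a , pa = a , Equivalence.to Bool.T-≡ pa

≡ᵇ-true⇒≡ : ∀ a b → (a ≡ᵇ b) ≡ true → a ≡ b
≡ᵇ-true⇒≡ a b eq = ≡ᵇ⇒≡ a b (Equivalence.from Bool.T-≡ eq)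

2≤k+[k≡1] : ∀ {k} → 1 ≤ k → 2 ≤ k + [ k ≡ᵇ 1 ]
2≤k+[k≡1] {1}           _ = ≤-refl
2≤k+[k≡1] {suc (suc k)} _ = s≤s (s≤s z≤n)

third-element : 3 ≤ m → (u v : Fin m) → ∃ λ w → w ≢ u × w ≢ v
third-element (s≤s (s≤s (s≤s _))) u v with zero ≟ u | zero ≟ v
... | no 0≢u   | no 0≢v = zero , 0≢u , 0≢v
... | yes refl | _ with suc zero ≟ v
...   | no 1≢v   = suc zero , (λ ()) , 1≢v
...   | yes refl = suc (suc zero) , (λ ()) , (λ ())
third-element (s≤s (s≤s (s≤s _))) u v | no _ | yes refl with suc zero ≟ u
...   | no 1≢u   = suc zero , 1≢u , (λ ())
...   | yes refl = suc (suc zero) , (λ ()) , (λ ())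

doubled : (Fin m → Bool) → Fin m → ℕ
doubled C u = if C u then 2 else 0

weight-doubled : (C : Fin m → Bool) → weight (doubled C) ≡ 2 * count C
weight-doubled C = trans (Σv-if-const C 2) (*-comm (count C) 2)

doubled-≤-2 : (C : Fin m → Bool) (u : Fin m) → doubled C u ≤ 2
doubled-≤-2 C u with C u
... | true  = ≤-refl
... | false = z≤n

doubled-zero : (C : Fin m → Bool) {u : Fin m} → doubled C u ≡ 0 → C u ≡ false
doubled-zero C {u} eq with C u | eq
... | false | _ = refl

doubled-covered : (C : Fin m → Bool) {u : Fin m} → C u ≡ true → doubled C u ≡ 2
doubled-covered C Cu = cong (λ b → if b then 2 else 0) Cu

module _ (G : Graph) where

  adj⇒≢ : ∀ {u w} → adj G u w ≡ true → u ≢ w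
  adj⇒≢ {u} u~w refl = Bool.not-¬ u~w (irrefl G u)

  nbrSum-≥-term : (f : Fin (n G) → ℕ) {v w : Fin (n G)} → adj G v w ≡ true → f w ≤ nbrSum G f v
  nbrSum-≥-term f {v} v~w = Σv-if-≥-term (adj G v) f v~w

  nbrSum-≥-2 : (f : Fin (n G) → ℕ) {u w : Fin (n G)} → adj G u w ≡ true → f w ≡ 2 → 2 ≤ nbrSum G f u
  nbrSum-≥-2 f {u} u~w fw≡2 = subst (_≤ nbrSum G f u) fw≡2 (nbrSum-≥-term f u~w)

  nbrSum-≥-pair : (f : Fin (n G) → ℕ) {v a b : Fin (n G)} →
                  adj G v a ≡ true → adj G v b ≡ true → a ≢ b → f a + f b ≤ nbrSum G f v
  nbrSum-≥-pair f {v} {a} {b} v~a v~b a≢b =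
    subst (_≤ nbrSum G f v) (cong₂ _+_ (term v~a) (term v~b))
      (Σv-≥-pair (λ u → if adj G v u then f u else 0) a≢b)
    where
    term : ∀ {x} → adj G v x ≡ true → (if adj G v x then f x else 0) ≡ f x
    term {x} v~x = cong (λ b → if b then f x else 0) v~x

  leaf-degree : ∀ {ℓ} → isLeaf G ℓ ≡ true → degree G ℓ ≡ 1
  leaf-degree {ℓ} leaf = ≡ᵇ-true⇒≡ (degree G ℓ) 1 leaf

  leaf-neighbour-unique : ∀ {ℓ a b} → isLeaf G ℓ ≡ true → adj G ℓ a ≡ true → adj G ℓ b ≡ true → a ≡ b
  leaf-neighbour-unique {ℓ} {a} {b} leaf ℓ~a ℓ~b with a ≟ b
  ... | yes a≡b = a≡b
  ... | no  a≢b = contradiction (subst (2 ≤_) (leaf-degree leaf) (nbrSum-≥-pair (const 1) ℓ~a ℓ~b a≢b))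
                                (<⇒≱ ≤-refl)

  nbrSum-leaf : (f : Fin (n G) → ℕ) {ℓ v : Fin (n G)} →
                isLeaf G ℓ ≡ true → adj G ℓ v ≡ true → nbrSum G f ℓ ≡ f v
  nbrSum-leaf f {ℓ} {v} leaf ℓ~v = trans (Σv-supported-at v off-v) (cong (λ b → if b then f v else 0) ℓ~v)
    where
    off-v : ∀ x → x ≢ v → (if adj G ℓ x then f x else 0) ≡ 0
    off-v x x≢v with adj G ℓ x in ℓ~x
    ... | true  = ⊥-elim (x≢v (leaf-neighbour-unique leaf ℓ~x ℓ~v))
    ... | false = refl

  nonLeaf-other-neighbour : ∀ {s a} → isLeaf G s ≡ false → adj G s a ≡ true →
                            ∃ λ w → adj G s w ≡ true × w ≢ a
  nonLeaf-other-neighbour {s} {a} nonLeaf s~a with any? (λ w → (adj G s w Bool.≟ true) ×-dec ¬? (w ≟ a))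
  ... | yes found = found
  ... | no  none  = ⊥-elim (Bool.not-¬ nonLeaf (cong (_≡ᵇ 1) degree≡1))
    where
    off-a : ∀ x → x ≢ a → [ adj G s x ] ≡ 0
    off-a x x≢a with adj G s x in s~x
    ... | true  = ⊥-elim (none (x , s~x , x≢a))
    ... | false = refl
    degree≡1 : degree G s ≡ 1
    degree≡1 = trans (Σv-supported-at a off-a) (cong [_] s~a)

  independent-complement-cover : ∀ {S} → Independent G S → IsVertexCover G (λ v → not (S v))
  independent-complement-cover {S} independent u w u~w with S u in Su | S w in Sw
  ... | false | _     = inj₁ refl
  ... | true  | false = inj₂ refl
  ... | true  | true  = ⊥-elim (Bool.not-¬ u~w (independent u w Su Sw))

  zero-neighbour-positive : ∀ {f} → IsCID G f → ∀ {v w} → f v ≡ 0 → adj G v w ≡ true → 1 ≤ f w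
  zero-neighbour-positive {f} cid {v} {w} fv≡0 v~w with f w in fw
  ... | zero  = ⊥-elim (Bool.not-¬ v~w (IsCID.zeroIndep cid v w fv≡0 fw))
  ... | suc _ = s≤s z≤n

  leafNbr : (Fin (n G) → Bool) → Fin (n G) → Fin (n G) → Bool
  leafNbr S v s = S s ∧ adj G v s ∧ isLeaf G s

  leafNbr-intro : ∀ {S v s} → S s ≡ true → adj G v s ≡ true → isLeaf G s ≡ true → leafNbr S v s ≡ true
  leafNbr-intro Ss v~s leaf rewrite Ss | v~s | leaf = refl

  Σv-leafNbr : (S : Fin (n G) → Bool) (s : Fin (n G)) (x : ℕ) →
               Σv (λ v → if leafNbr S v s then x else 0) ≡ (if S s ∧ isLeaf G s then x else 0)
  Σv-leafNbr S s x with S s | isLeaf G s in leaf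
  ... | false | _     = Σv-zero {n G} _ (λ _ → refl)
  ... | true  | false = Σv-zero {n G} _ (λ v → cong (λ b → if b then x else 0) (Bool.∧-zeroʳ (adj G v s)))
  ... | true  | true  = begin
    Σv (λ v → if adj G v s ∧ true then x else 0)  ≡⟨ Σv-cong (λ v → cong (λ b → if b then x else 0)
                                                                         (adj-∧ v)) ⟩
    Σv (λ v → if adj G s v then x else 0)         ≡⟨ Σv-if-const (adj G s) x ⟩
    degree G s * x                                ≡⟨ cong (_* x) (leaf-degree leaf) ⟩
    1 * x                                         ≡⟨ *-identityˡ x ⟩
    x                                             ∎
    where
    open ≡-Reasoning
    adj-∧ : ∀ v → adj G v s ∧ true ≡ adj G s v
    adj-∧ v = trans (Bool.∧-identityʳ _) (adj-sym G v s)

  module Connectivity (connected : Connected G) (n≥3 : 3 ≤ n G) where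

    has-neighbour : (u : Fin (n G)) → ∃ λ w → adj G u w ≡ true
    has-neighbour u with third-element n≥3 u u
    ... | x , x≢u , _ = first-step (connected u x) x≢u
      where
      first-step : ∀ {u x} → Reach G u x → x ≢ u → ∃ λ w → adj G u w ≡ true
      first-step here          x≢x = ⊥-elim (x≢x refl)
      first-step (step u~w _) _   = _ , u~w

    no-isolated-edge : ∀ {v ℓ} → (∀ w → adj G v w ≡ true → w ≡ ℓ) → (∀ w → adj G ℓ w ≡ true → w ≡ v) → ⊥
    no-isolated-edge {v} {ℓ} only-ℓ only-v with third-element n≥3 v ℓ
    ... | x , x≢v , x≢ℓ with stays (connected v x) (inj₁ refl)
      where
      stays : ∀ {a y} → Reach G a y → a ≡ v ⊎ a ≡ ℓ → y ≡ v ⊎ y ≡ ℓ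
      stays here                 a∈vℓ        = a∈vℓ
      stays (step {w = w} a~w r) (inj₁ refl) = stays r (inj₂ (only-ℓ w a~w))
      stays (step {w = w} a~w r) (inj₂ refl) = stays r (inj₁ (only-v w a~w))
    ... | inj₁ x≡v = x≢v x≡v
    ... | inj₂ x≡ℓ = x≢ℓ x≡ℓ

  module VertexCover {C : Fin (n G) → Bool} (cover : IsVertexCover G C) where

    uncovered-neighbour : ∀ {u w} → C u ≡ false → adj G u w ≡ true → C w ≡ true
    uncovered-neighbour Cu u~w with cover _ _ u~w
    ... | inj₁ Cu≡true = ⊥-elim (Bool.not-¬ Cu≡true Cu)
    ... | inj₂ Cw      = Cw

    uncovered-independent : ∀ {u w} → C u ≡ false → C w ≡ false → adj G u w ≡ false
    uncovered-independent Cu Cw = Bool.¬-not λ u~w → Bool.not-¬ (uncovered-neighbour Cu u~w) Cw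

    doubled-isCID : Connected G → 3 ≤ n G → IsCID G (doubled C)
    doubled-isCID connected n≥3 = record
      { range     = doubled-≤-2 C
      ; italian   = italian
      ; zeroIndep = λ u v du≡0 dv≡0 → uncovered-independent (doubled-zero C du≡0) (doubled-zero C dv≡0)
      }
      where
      open Connectivity connected n≥3
      italian : ∀ u → doubled C u ≡ 0 → 2 ≤ nbrSum G (doubled C) u
      italian u du≡0 with has-neighbour u
      ... | w , u~w = nbrSum-≥-2 (doubled C) u~w
                        (doubled-covered C (uncovered-neighbour (doubled-zero C du≡0) u~w))

  cid≤2β : Connected G → 3 ≤ n G → ∀ {b c} → IsVertexCoverNumber G b → IsCIDNumber G c → c ≤ 2 * b
  cid≤2β connected n≥3 ((C , cover , |C|≡b) , _) (_ , minimal) =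
    subst (_ ≤_) (trans (weight-doubled C) (cong (2 *_) |C|≡b))
      (minimal (doubled C) (VertexCover.doubled-isCID cover connected n≥3))

  module FamilyLowerBound {S : Fin (n G) → Bool} (family : InFamilyWith G S)
                          {f : Fin (n G) → ℕ} (cid : IsCID G f) where
    open InFamilyWith family
    open IsCID cid

    leafWeight : Fin (n G) → ℕ
    leafWeight v = Σv (λ ℓ → if leafNbr S v ℓ then f ℓ else 0)

    -- The vertices v ∉ S for which f v + leafWeight v may be as small as 1; each
    -- of them borrows one unit from a non-leaf neighbour in S.
    deficient : Fin (n G) → Bool
    deficient v = not (S v) ∧ (f v ≡ᵇ 0) ∧ (leafNbrsIn G S v ≡ᵇ 1)

    deficient-at-zero : ∀ {v} → S v ≡ false → f v ≡ 0 → deficient v ≡ (leafNbrsIn G S v ≡ᵇ 1)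
    deficient-at-zero Sv fv≡0 rewrite Sv | fv≡0 = refl

    deficient-zero : ∀ {v} → deficient v ≡ true → f v ≡ 0
    deficient-zero {v} dv = ≡ᵇ-true⇒≡ (f v) 0 (Bool.∧-conicalˡ _ _ (Bool.∧-conicalʳ (not (S v)) _ dv))

    deficient-premise : ∀ v → deficient v ≡ true → S v ≡ false × leafNbrsIn G S v ≡ 1
    deficient-premise v dv =
      Bool.not-injective (Bool.∧-conicalˡ _ _ dv) ,
      ≡ᵇ-true⇒≡ _ 1 (Bool.∧-conicalʳ _ _ (Bool.∧-conicalʳ (not (S v)) _ dv))

    deficient-independent : Independent G deficient
    deficient-independent u v du dv = zeroIndep u v (deficient-zero du) (deficient-zero dv)

    leafWeight-≥-count : ∀ {v} → f v ≡ 0 → leafNbrsIn G S v ≤ leafWeight v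
    leafWeight-≥-count {v} fv≡0 = Σv-mono-≤ positive
      where
      positive : ∀ ℓ → [ leafNbr S v ℓ ] ≤ (if leafNbr S v ℓ then f ℓ else 0)
      positive ℓ with leafNbr S v ℓ in vℓ
      ... | true  = zero-neighbour-positive cid fv≡0 (Bool.∧-conicalˡ _ _ (Bool.∧-conicalʳ (S ℓ) _ vℓ))
      ... | false = z≤n

    charge-≥-2 : ∀ {v} → S v ≡ false → 2 ≤ f v + leafWeight v + [ deficient v ]
    charge-≥-2 {v} Sv with twoNbrs v Sv
    ... | s , _ , _ , Ss , _ , v~s , _ , leaf-s = by-value (f v) refl
      where
      vs : leafNbr S v s ≡ true
      vs = leafNbr-intro {S} Ss v~s leaf-s

      charge≥ : ∀ {x} → x ≤ f v + leafWeight v → x ≤ f v + leafWeight v + [ deficient v ]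
      charge≥ x≤ = ≤-trans x≤ (m≤m+n _ _)

      by-value : ∀ k → f v ≡ k → 2 ≤ f v + leafWeight v + [ deficient v ]
      by-value (suc (suc _)) fv = charge≥ (≤-trans (subst (2 ≤_) (sym fv) (s≤s (s≤s z≤n))) (m≤m+n _ _))
      by-value 1             fv =
        charge≥ (+-mono-≤ (≤-reflexive (sym fv)) (≤-trans fs≥1 (Σv-if-≥-term (leafNbr S v) f vs)))
        where
        fs≥1 : 1 ≤ f s
        fs≥1 with f s in fs
        ... | suc _ = s≤s z≤n
        ... | zero  = contradiction (subst (2 ≤_) nbrSum≡1 (italian s fs)) (<⇒≱ ≤-refl)
          where
          nbrSum≡1 : nbrSum G f s ≡ 1
          nbrSum≡1 = trans (nbrSum-leaf f leaf-s (trans (adj-sym G s v) v~s)) fv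
      by-value 0             fv = begin
        2                                                ≤⟨ 2≤k+[k≡1] (Σv-if-≥-term (leafNbr S v) (const 1) vs) ⟩
        leafNbrsIn G S v + [ leafNbrsIn G S v ≡ᵇ 1 ]     ≤⟨ +-monoˡ-≤ _ (leafWeight-≥-count fv) ⟩
        leafWeight v + [ leafNbrsIn G S v ≡ᵇ 1 ]         ≡⟨ cong₂ (λ x d → x + leafWeight v + [ d ])
                                                                    (sym fv) (sym (deficient-at-zero Sv fv)) ⟩
        f v + leafWeight v + [ deficient v ]             ∎
        where open ≤-Reasoning

    count-deficient-≤ : count deficient ≤ Σv (λ ℓ → if S ℓ ∧ not (isLeaf G ℓ) then f ℓ else 0)
    count-deficient-≤ =
      ≤-trans (hall deficient deficient-independent deficient-premise) (Σv-mono-≤ lender-positive)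
      where
      lender-positive : ∀ ℓ → [ S ℓ ∧ not (isLeaf G ℓ) ∧ any (λ v → deficient v ∧ adj G v ℓ) (allFin (n G)) ]
                              ≤ (if S ℓ ∧ not (isLeaf G ℓ) then f ℓ else 0)
      lender-positive ℓ with S ℓ | isLeaf G ℓ | any (λ v → deficient v ∧ adj G v ℓ) (allFin (n G)) in lends
      ... | true  | false | true  with any-allFin⁻ (λ v → deficient v ∧ adj G v ℓ) lends
      ...   | v , dv∧v~ℓ = zero-neighbour-positive cid (deficient-zero (Bool.∧-conicalˡ _ _ dv∧v~ℓ))
                                                       (Bool.∧-conicalʳ (deficient v) _ dv∧v~ℓ)
      lender-positive ℓ | true  | false | false = z≤n
      lender-positive ℓ | true  | true  | _     = z≤n
      lender-positive ℓ | false | _     | _     = z≤n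

    Σv-leafWeight : Σv leafWeight ≡ Σv (λ ℓ → if S ℓ ∧ isLeaf G ℓ then f ℓ else 0)
    Σv-leafWeight =
      trans (Σv-comm (λ v ℓ → if leafNbr S v ℓ then f ℓ else 0)) (Σv-cong λ ℓ → Σv-leafNbr S ℓ (f ℓ))

    weight-≥-2|V∖S| : 2 * count (λ v → not (S v)) ≤ weight f
    weight-≥-2|V∖S| = begin
      2 * count H                                           ≡⟨ sym (weight-doubled H) ⟩
      Σv (doubled H)                                        ≤⟨ Σv-mono-≤ (λ v → charge v (S v) refl) ⟩
      Σv (λ v → outside v + leafWeight v + [ deficient v ]) ≡⟨ Σv-distrib³ ⟩
      Σv outside + Σv leafWeight + count deficient          ≤⟨ +-mono-≤ (≤-reflexive (cong (Σv outside +_)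
                                                                                         Σv-leafWeight))
                                                                        count-deficient-≤ ⟩
      Σv outside + Σv (λ ℓ → if S ℓ ∧ isLeaf G ℓ then f ℓ else 0)
        + Σv (λ ℓ → if S ℓ ∧ not (isLeaf G ℓ) then f ℓ else 0) ≡⟨ weight-partition S (isLeaf G) f ⟩
      weight f                                              ∎
      where
      open ≤-Reasoning
      H : Fin (n G) → Bool
      H v = not (S v)
      outside : Fin (n G) → ℕ
      outside v = if H v then f v else 0
      Σv-distrib³ : Σv (λ v → outside v + leafWeight v + [ deficient v ])
                    ≡ Σv outside + Σv leafWeight + count deficient
      Σv-distrib³ = trans (Σv-distrib-+ (λ v → outside v + leafWeight v) _)
                          (cong (_+ count deficient) (Σv-distrib-+ outside leafWeight))
      charge : ∀ v b → S v ≡ b → doubled H v ≤ outside v + leafWeight v + [ deficient v ]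
      charge v true  Sv = subst (_≤ outside v + leafWeight v + [ deficient v ])
                            (sym (cong (λ b → if not b then 2 else 0) Sv)) z≤n
      charge v false Sv = subst₂ (λ d o → d ≤ o + leafWeight v + [ deficient v ])
                            (sym (cong (λ b → if not b then 2 else 0) Sv))
                            (sym (cong (λ b → if not b then f v else 0) Sv))
                            (charge-≥-2 Sv)

  module TightCover (connected : Connected G) (n≥3 : 3 ≤ n G)
                    {C : Fin (n G) → Bool} (cover : IsVertexCover G C)
                    (tight : ∀ f → IsCID G f → 2 * count C ≤ weight f) where
    open Connectivity connected n≥3
    open VertexCover cover

    S : Fin (n G) → Bool
    S v = not (C v)

    not-lighter : ∀ {f} → IsCID G f → ¬ (weight f < 2 * count C)
    not-lighter {f} cid lighter = <⇒≱ lighter (tight f cid)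

    weight-doubled-updateAt : ∀ {v} → C v ≡ true → ∀ k →
                              k + 2 * count C ≡ 2 + weight (updateAt (doubled C) v (const k))
    weight-doubled-updateAt {v} Cv k = begin
      k + 2 * count C         ≡⟨ cong (k +_) (sym (weight-doubled C)) ⟩
      k + weight (doubled C)  ≡⟨ sym (Σv-updateAt (doubled C) v k) ⟩
      doubled C v + weight d′ ≡⟨ cong (_+ weight d′) (doubled-covered C Cv) ⟩
      2 + weight d′           ∎
      where
      open ≡-Reasoning
      d′ : Fin (n G) → ℕ
      d′ = updateAt (doubled C) v (const k)

    module LeaflessVertex {v} (Cv : C v ≡ true)
                          (leafless : ¬ (∃ λ s → S s ≡ true × adj G v s ≡ true × isLeaf G s ≡ true)) where

      lowered : Fin (n G) → ℕ
      lowered = updateAt (doubled C) v (const 1)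

      lowered-lighter : weight lowered < 2 * count C
      lowered-lighter = ≤-reflexive (sym (suc-injective (weight-doubled-updateAt Cv 1)))

      lowered-covered : ∀ {w} → w ≢ v → C w ≡ true → lowered w ≡ 2
      lowered-covered {w} w≢v Cw = trans (updateAt-minimal w v (doubled C) w≢v) (doubled-covered C Cw)

      lowered-zero : ∀ {u} → lowered u ≡ 0 → C u ≡ false
      lowered-zero {u} lu≡0 with updateAt-cases (doubled C) v 1 u
      ... | inj₁ (_ , lu≡1) = contradiction (trans (sym lu≡1) lu≡0) λ ()
      ... | inj₂ (_ , lu≡d) = doubled-zero C (trans (sym lu≡d) lu≡0)

      next-to-v-not-leaf : ∀ {u} → C u ≡ false → adj G u v ≡ true → isLeaf G u ≡ false
      next-to-v-not-leaf {u} Cu u~v =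
        Bool.¬-not λ leaf → leafless (u , cong not Cu , trans (adj-sym G v u) u~v , leaf)

      lowered-italian : ∀ u → lowered u ≡ 0 → 2 ≤ nbrSum G lowered u
      lowered-italian u lu≡0 with lowered-zero lu≡0 | has-neighbour u
      ... | Cu | a , u~a with a ≟ v
      ...   | no a≢v   = nbrSum-≥-2 lowered u~a (lowered-covered a≢v (uncovered-neighbour Cu u~a))
      ...   | yes refl with nonLeaf-other-neighbour (next-to-v-not-leaf Cu u~a) u~a
      ...     | w , u~w , w≢v = nbrSum-≥-2 lowered u~w (lowered-covered w≢v (uncovered-neighbour Cu u~w))

      lowered-isCID : IsCID G lowered
      lowered-isCID = record
        { range     = updateAt-≤ (doubled-≤-2 C) (s≤s z≤n) v
        ; italian   = lowered-italian
        ; zeroIndep = λ u w lu≡0 lw≡0 → uncovered-independent (lowered-zero lu≡0) (lowered-zero lw≡0)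
        }

    covered-has-leaf : ∀ {v} → C v ≡ true → ∃ λ s → S s ≡ true × adj G v s ≡ true × isLeaf G s ≡ true
    covered-has-leaf {v} Cv
      with any? (λ s → (S s Bool.≟ true) ×-dec (adj G v s Bool.≟ true) ×-dec (isLeaf G s Bool.≟ true))
    ... | yes found   = found
    ... | no leafless = ⊥-elim (not-lighter lowered-isCID lowered-lighter)
      where open LeaflessVertex Cv leafless

    module LeafOnlyUncoveredNeighbour {v s} (Cv : C v ≡ true) (Ss : S s ≡ true) (v~s : adj G v s ≡ true)
                                      (leaf : isLeaf G s ≡ true)
                                      (only-s : ¬ (∃ λ s′ → S s′ ≡ true × adj G v s′ ≡ true × s′ ≢ s)) where

      Cs : C s ≡ false
      Cs = Bool.not-injective Ss

      s≢v : s ≢ v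
      s≢v s≡v = Bool.not-¬ Cv (trans (cong C (sym s≡v)) Cs)

      other-neighbour-covered : ∀ {w} → adj G v w ≡ true → w ≢ s → C w ≡ true
      other-neighbour-covered {w} v~w w≢s = Bool.¬-not λ Cw → only-s (w , cong not Cw , v~w , w≢s)

      emptied shifted : Fin (n G) → ℕ
      emptied = updateAt (doubled C) v (const 0)
      shifted = updateAt emptied s (const 1)

      shifted-lighter : weight shifted < 2 * count C
      shifted-lighter = ≤-reflexive (begin
        suc (weight shifted)      ≡⟨ cong suc (trans (cong (_+ weight shifted) (sym emptied-s))
                                                     (Σv-updateAt emptied s 1)) ⟩
        2 + weight emptied        ≡⟨ sym (weight-doubled-updateAt Cv 0) ⟩
        2 * count C               ∎)
        where
        open ≡-Reasoning
        emptied-s : emptied s ≡ 0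
        emptied-s = trans (updateAt-minimal s v (doubled C) s≢v) (cong (λ b → if b then 2 else 0) Cs)

      shifted-covered : ∀ {w} → w ≢ v → w ≢ s → C w ≡ true → shifted w ≡ 2
      shifted-covered {w} w≢v w≢s Cw =
        trans (updateAt-minimal w s emptied w≢s)
              (trans (updateAt-minimal w v (doubled C) w≢v) (doubled-covered C Cw))

      shifted-zero : ∀ {u} → shifted u ≡ 0 → u ≡ v ⊎ (u ≢ s × C u ≡ false)
      shifted-zero {u} su≡0 with updateAt-cases emptied s 1 u
      ... | inj₁ (_ , su≡1) = contradiction (trans (sym su≡1) su≡0) λ ()
      ... | inj₂ (u≢s , su≡eu) with updateAt-cases (doubled C) v 0 u
      ...   | inj₁ (u≡v , _)  = inj₁ u≡v
      ...   | inj₂ (_ , eu≡d) = inj₂ (u≢s , doubled-zero C (trans (sym eu≡d) (trans (sym su≡eu) su≡0)))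

      v-has-other-neighbour : ∃ λ w → adj G v w ≡ true × w ≢ s
      v-has-other-neighbour with any? (λ w → (adj G v w Bool.≟ true) ×-dec ¬? (w ≟ s))
      ... | yes found  = found
      ... | no  s-only = ⊥-elim (no-isolated-edge only-neighbour-s only-neighbour-v)
        where
        only-neighbour-s : ∀ w → adj G v w ≡ true → w ≡ s
        only-neighbour-s w v~w with w ≟ s
        ... | yes w≡s = w≡s
        ... | no  w≢s = ⊥-elim (s-only (w , v~w , w≢s))
        only-neighbour-v : ∀ w → adj G s w ≡ true → w ≡ v
        only-neighbour-v w s~w = leaf-neighbour-unique leaf s~w (trans (adj-sym G s v) v~s)

      shifted-italian : ∀ u → shifted u ≡ 0 → 2 ≤ nbrSum G shifted u
      shifted-italian u su≡0 with shifted-zero su≡0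
      ... | inj₁ refl with v-has-other-neighbour
      ...   | w , v~w , w≢s =
        nbrSum-≥-2 shifted v~w (shifted-covered (adj⇒≢ v~w ∘ sym) w≢s (other-neighbour-covered v~w w≢s))
      shifted-italian u su≡0 | inj₂ (u≢s , Cu) with has-neighbour u
      ... | a , u~a = nbrSum-≥-2 shifted u~a (shifted-covered a≢v a≢s Ca)
        where
        Ca : C a ≡ true
        Ca = uncovered-neighbour Cu u~a
        a≢s : a ≢ s
        a≢s a≡s = Bool.not-¬ Ca (trans (cong C a≡s) Cs)
        a≢v : a ≢ v
        a≢v refl = only-s (u , cong not Cu , trans (adj-sym G a u) u~a , u≢s)

      shifted-zeros-apart : ∀ {u w} → u ≡ v ⊎ (u ≢ s × C u ≡ false) → w ≡ v ⊎ (w ≢ s × C w ≡ false) →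
                            adj G u w ≢ true
      shifted-zeros-apart (inj₁ refl)           (inj₁ refl)       v~v = adj⇒≢ v~v refl
      shifted-zeros-apart (inj₁ refl)           (inj₂ (w≢s , Cw)) v~w = only-s (_ , cong not Cw , v~w , w≢s)
      shifted-zeros-apart {u} (inj₂ (u≢s , Cu)) (inj₁ refl)       u~v =
        only-s (u , cong not Cu , trans (adj-sym G v u) u~v , u≢s)
      shifted-zeros-apart (inj₂ (_ , Cu))       (inj₂ (_ , Cw))   u~w =
        Bool.not-¬ u~w (uncovered-independent Cu Cw)

      shifted-isCID : IsCID G shifted
      shifted-isCID = record
        { range     = updateAt-≤ (updateAt-≤ (doubled-≤-2 C) z≤n v) (s≤s z≤n) s
        ; italian   = shifted-italian
        ; zeroIndep = λ u w su≡0 sw≡0 →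
                        Bool.¬-not (shifted-zeros-apart (shifted-zero su≡0) (shifted-zero sw≡0))
        }

    covered-has-second : ∀ {v s} → C v ≡ true → S s ≡ true → adj G v s ≡ true → isLeaf G s ≡ true →
                         ∃ λ s′ → S s′ ≡ true × adj G v s′ ≡ true × s′ ≢ s
    covered-has-second {v} {s} Cv Ss v~s leaf
      with any? (λ s′ → (S s′ Bool.≟ true) ×-dec (adj G v s′ Bool.≟ true) ×-dec ¬? (s′ ≟ s))
    ... | yes found  = found
    ... | no  only-s = ⊥-elim (not-lighter shifted-isCID shifted-lighter)
      where open LeafOnlyUncoveredNeighbour Cv Ss v~s leaf only-s

    module HallViolation (I : Fin (n G) → Bool) (independent : Independent G I)
                         (premise : ∀ v → I v ≡ true → S v ≡ false × leafNbrsIn G S v ≡ 1) where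

      touched : Fin (n G) → Bool
      touched u = any (λ v → I v ∧ adj G v u) (allFin (n G))

      redistributed : Fin (n G) → ℕ
      redistributed u = if I u then 0 else if C u then 2 else if touched u then 1 else 0

      I⇒C : ∀ {v} → I v ≡ true → C v ≡ true
      I⇒C {v} Iv = Bool.not-injective (proj₁ (premise v Iv))

      ¬C⇒¬I : ∀ {v} → C v ≡ false → I v ≡ false
      ¬C⇒¬I Cv = Bool.¬-not λ Iv → Bool.not-¬ (I⇒C Iv) Cv

      touched-intro : ∀ {v u} → I v ≡ true → adj G v u ≡ true → touched u ≡ true
      touched-intro {v} {u} Iv v~u = any-allFin⁺ (λ w → I w ∧ adj G w u) v (cong₂ _∧_ Iv v~u)

      redistributed-covered : ∀ {u} → I u ≡ false → C u ≡ true → redistributed u ≡ 2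
      redistributed-covered Iu Cu rewrite Iu | Cu = refl

      redistributed-touched : ∀ {u} → S u ≡ true → touched u ≡ true → redistributed u ≡ 1
      redistributed-touched {u} Su tu rewrite ¬C⇒¬I (Bool.not-injective Su) | Bool.not-injective Su | tu = refl

      redistributed-zero : ∀ {u} → redistributed u ≡ 0 → I u ≡ true ⊎ (C u ≡ false × touched u ≡ false)
      redistributed-zero {u} ru≡0 with I u | C u | touched u | ru≡0
      ... | true  | _     | _     | _ = inj₁ refl
      ... | false | false | false | _ = inj₂ (refl , refl)

      redistributed-≤-2 : ∀ u → redistributed u ≤ 2
      redistributed-≤-2 u with I u | C u | touched u
      ... | true  | _     | _     = z≤n
      ... | false | true  | _     = ≤-refl
      ... | false | false | true  = s≤s z≤n
      ... | false | false | false = z≤n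

      redistributed-italian : ∀ u → redistributed u ≡ 0 → 2 ≤ nbrSum G redistributed u
      redistributed-italian u ru≡0 with redistributed-zero ru≡0
      ... | inj₁ Iu with covered-has-leaf (I⇒C Iu)
      ...   | s₁ , Ss₁ , u~s₁ , leaf₁ with covered-has-second (I⇒C Iu) Ss₁ u~s₁ leaf₁
      ...     | s₂ , Ss₂ , u~s₂ , s₂≢s₁ =
        subst (_≤ nbrSum G redistributed u)
          (cong₂ _+_ (redistributed-touched Ss₁ (touched-intro Iu u~s₁))
                     (redistributed-touched Ss₂ (touched-intro Iu u~s₂)))
          (nbrSum-≥-pair redistributed u~s₁ u~s₂ (s₂≢s₁ ∘ sym))
      redistributed-italian u ru≡0 | inj₂ (Cu , untouched) with has-neighbour u
      ... | a , u~a = nbrSum-≥-2 redistributed u~a (redistributed-covered ¬Ia (uncovered-neighbour Cu u~a))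
        where
        ¬Ia : I a ≡ false
        ¬Ia = Bool.¬-not λ Ia → Bool.not-¬ (touched-intro Ia (trans (adj-sym G a u) u~a)) untouched

      redistributed-zeros-apart : ∀ {u w} → I u ≡ true ⊎ (C u ≡ false × touched u ≡ false) →
                                  I w ≡ true ⊎ (C w ≡ false × touched w ≡ false) → adj G u w ≡ false
      redistributed-zeros-apart (inj₁ Iu)             (inj₁ Iw)             = independent _ _ Iu Iw
      redistributed-zeros-apart (inj₁ Iu)             (inj₂ (_ , untouched)) =
        Bool.¬-not λ u~w → Bool.not-¬ (touched-intro Iu u~w) untouched
      redistributed-zeros-apart {u} {w} (inj₂ (_ , untouched)) (inj₁ Iw) =
        Bool.¬-not λ u~w → Bool.not-¬ (touched-intro Iw (trans (adj-sym G w u) u~w)) untouched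
      redistributed-zeros-apart (inj₂ (Cu , _))       (inj₂ (Cw , _))       = uncovered-independent Cu Cw

      redistributed-isCID : IsCID G redistributed
      redistributed-isCID = record
        { range     = redistributed-≤-2
        ; italian   = redistributed-italian
        ; zeroIndep = λ u w ru≡0 rw≡0 →
                        redistributed-zeros-apart (redistributed-zero ru≡0) (redistributed-zero rw≡0)
        }

      leafTouched nonLeafTouched : Fin (n G) → Bool
      leafTouched    s = S s ∧ isLeaf G s ∧ touched s
      nonLeafTouched s = S s ∧ not (isLeaf G s) ∧ touched s

      -- Double counting of the pairs (v, s) with v ∈ I and s a leaf of S at v.
      count-leafTouched-≤ : count leafTouched ≤ count I
      count-leafTouched-≤ = begin
        count leafTouched                 ≤⟨ Σv-mono-≤ has-I-neighbour ⟩
        Σv (λ s → Σv (λ v → incid v s))   ≡⟨ sym (Σv-comm incid) ⟩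
        Σv (λ v → Σv (incid v))           ≡⟨ Σv-cong one-leaf ⟩
        count I                           ∎
        where
        open ≤-Reasoning
        incid : Fin (n G) → Fin (n G) → ℕ
        incid v s = if I v then [ leafNbr S v s ] else 0
        has-I-neighbour : ∀ s → [ leafTouched s ] ≤ Σv (λ v → incid v s)
        has-I-neighbour s with leafTouched s in ls
        ... | false = z≤n
        ... | true
          with any-allFin⁻ (λ v → I v ∧ adj G v s) (Bool.∧-conicalʳ _ _ (Bool.∧-conicalʳ (S s) _ ls))
        ...   | v , Iv∧v~s = subst (_≤ Σv (λ v → incid v s)) incid≡1 (Σv-≥-term (λ v → incid v s) v)
          where
          incid≡1 : incid v s ≡ 1
          incid≡1 rewrite Bool.∧-conicalˡ (I v) _ Iv∧v~s
                        | leafNbr-intro {S} (Bool.∧-conicalˡ _ _ ls) (Bool.∧-conicalʳ (I v) _ Iv∧v~s)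
                                            (Bool.∧-conicalˡ _ _ (Bool.∧-conicalʳ (S s) _ ls)) = refl
        one-leaf : ∀ v → Σv (incid v) ≡ [ I v ]
        one-leaf v with I v in Iv
        ... | true  = proj₂ (premise v Iv)
        ... | false = Σv-zero {n G} _ (λ _ → refl)

      weight-redistributed : weight redistributed + 2 * count I
                             ≡ 2 * count C + (count leafTouched + count nonLeafTouched)
      weight-redistributed = begin
        weight redistributed + 2 * count I
          ≡⟨ cong (weight redistributed +_) (sym (weight-doubled I)) ⟩
        weight redistributed + Σv (doubled I)
          ≡⟨ sym (Σv-distrib-+ redistributed (doubled I)) ⟩
        Σv (λ u → redistributed u + doubled I u)
          ≡⟨ Σv-cong (λ u → pointwise (I u) (C u) (isLeaf G u) (touched u) I⇒C) ⟩
        Σv (λ u → doubled C u + ([ leafTouched u ] + [ nonLeafTouched u ]))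
          ≡⟨ Σv-distrib-+ (doubled C) _ ⟩
        Σv (doubled C) + Σv (λ u → [ leafTouched u ] + [ nonLeafTouched u ])
          ≡⟨ cong₂ _+_ (weight-doubled C) (Σv-distrib-+ (λ u → [ leafTouched u ]) _) ⟩
        2 * count C + (count leafTouched + count nonLeafTouched)
          ∎
        where
        open ≡-Reasoning
        pointwise : ∀ i c l t → (i ≡ true → c ≡ true) →
                    (if i then 0 else if c then 2 else if t then 1 else 0) + (if i then 2 else 0)
                    ≡ (if c then 2 else 0) + ([ not c ∧ l ∧ t ] + [ not c ∧ not l ∧ t ])
        pointwise true  true  _     _     _ = refl
        pointwise true  false _     _     i⇒c with () ← i⇒c refl
        pointwise false true  _     _     _ = refl
        pointwise false false true  true  _ = refl
        pointwise false false true  false _ = refl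
        pointwise false false false true  _ = refl
        pointwise false false false false _ = refl

      redistributed-lighter : nonLeafNbrsOfSetIn G S I < count I → weight redistributed < 2 * count C
      redistributed-lighter T<I = +-cancelʳ-< (2 * count I) (weight redistributed) (2 * count C) (begin-strict
        weight redistributed + 2 * count I                         ≡⟨ weight-redistributed ⟩
        2 * count C + (count leafTouched + count nonLeafTouched)   <⟨ +-monoʳ-< (2 * count C)
                                                                        (+-mono-≤-< count-leafTouched-≤ T<I) ⟩
        2 * count C + (count I + count I)                          ≡⟨ cong (λ x → 2 * count C + (count I + x))
                                                                        (sym (+-identityʳ (count I))) ⟩
        2 * count C + 2 * count I                                  ∎)
        where open ≤-Reasoning

    hall-condition : (I : Fin (n G) → Bool) → Independent G I →
                     (∀ v → I v ≡ true → S v ≡ false × leafNbrsIn G S v ≡ 1) →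
                     count I ≤ nonLeafNbrsOfSetIn G S I
    hall-condition I independent premise with count I ≤? nonLeafNbrsOfSetIn G S I
    ... | yes holds   = holds
    ... | no violated = ⊥-elim (not-lighter redistributed-isCID (redistributed-lighter (≰⇒> violated)))
      where open HallViolation I independent premise

    tight-family : InFamilyWith G S
    tight-family = record
      { S-indep = λ u w Su Sw → uncovered-independent (Bool.not-injective Su) (Bool.not-injective Sw)
      ; twoNbrs = two-neighbours
      ; hall    = hall-condition
      }
      where
      two-neighbours : ∀ v → S v ≡ false →
                       Σ (Fin (n G)) λ s₁ → Σ (Fin (n G)) λ s₂ →
                         ¬ (s₁ ≡ s₂) × S s₁ ≡ true × S s₂ ≡ true
                         × adj G v s₁ ≡ true × adj G v s₂ ≡ true × isLeaf G s₁ ≡ true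
      two-neighbours v Sv with covered-has-leaf (Bool.not-injective Sv)
      ... | s₁ , Ss₁ , v~s₁ , leaf with covered-has-second (Bool.not-injective Sv) Ss₁ v~s₁ leaf
      ...   | s₂ , Ss₂ , v~s₂ , s₂≢s₁ = s₁ , s₂ , s₂≢s₁ ∘ sym , Ss₁ , Ss₂ , v~s₁ , v~s₂ , leaf

theorem5 : (G : Graph) → Connected G → 3 ≤ n G →
           (b c : ℕ) → IsVertexCoverNumber G b → IsCIDNumber G c →
           ((c ≡ 2 * b → InFamily G) × (InFamily G → c ≡ 2 * b))
theorem5 G connected n≥3 b c β@((C , cover , |C|≡b) , β-minimal) γ@((f , f-isCID , weight≡c) , γ-minimal)
  = tight⇒family , family⇒tight
  where
  tight⇒family : c ≡ 2 * b → InFamily G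
  tight⇒family c≡2b = _ , TightCover.tight-family G connected n≥3 cover
    λ g g-isCID → subst (_≤ weight g) (trans c≡2b (cong (2 *_) (sym |C|≡b))) (γ-minimal g g-isCID)

  family⇒tight : InFamily G → c ≡ 2 * b
  family⇒tight (S , family) = ≤-antisym (cid≤2β G connected n≥3 β γ) (begin
    2 * b                        ≤⟨ *-monoʳ-≤ 2 (β-minimal _ complement-cover) ⟩
    2 * count (λ v → not (S v))  ≤⟨ FamilyLowerBound.weight-≥-2|V∖S| G family f-isCID ⟩
    weight f                     ≡⟨ weight≡c ⟩
    c                            ∎)
    where
    open ≤-Reasoning
    complement-cover : IsVertexCover G (λ v → not (S v))
    complement-cover = independent-complement-cover G (InFamilyWith.S-indep family)
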